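{- Let $\mathcal{P}$ be a chiral $(2k+1)$-polytope with base flag $\Phi$, and for $1\le i\le 2k$ let $\tau_i$ be the automorphism with $\Phi\tau_i=r_ir_0\Phi$. Let $\epsilon_i=-1$ if $i\equiv 2k+1\pmod{4k}$ and $\epsilon_i=1$ otherwise. Let $j$ be a positive integer. If $j\not\equiv\lfloor (j-1)/(2k)\rfloor \pmod 2$, then \[\Phi\prod_{i=1}^{j}\tau_i^{\epsilon_i}=\prod_{i=0}^{j+\lfloor (j-1)/(2k)\rfloor} r_i\,\Phi,\] and if $j\equiv\lfloor (j-1)/(2k)\rfloor\pmod 2$, then \[\Phi\prod_{i=1}^{j}\tau_i^{\epsilon_i}=r_0\prod_{i=0}^{j+\lfloor (j-1)/(2k)\rfloor} r_i\,\Phi,\] where the subscript of $r_i$ is taken modulo $2k+1$ and the subscript of $\tau_i$ modulo $2k$ (using $\tau_{2k}$ when the subscript is $\equiv 0$).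
   Context: An $n$-maniplex is a connected simple graph with edges colored by $\{0,\dots,n-1\}$, each vertex (flag) incident to exactly one edge of each color, and alternating paths of length 4 in colors $i,j$ closed whenever $|i-j|>1$. $r_i$ is the permutation of flags sending a flag to the flag joined to it by its edge of color $i$; monodromies act on the left. Automorphisms are color-preserving graph automorphisms and act on the right, so $\Phi(\alpha\beta)=(\Phi\alpha)\beta$, and they commute with the $r_i$. An abstract $n$-polytope is an $n$-maniplex such that if two flags are joined by a path with colors in $[0,m]$ and by a path with colors in $[k',n-1]$ then they are joined by one with colors in $[k',m]$. A maniplex is chiral if its automorphism group has exactly two orbits on flags and any two flags joined by an edge lie in different orbits. Products are written from right to left: $\prod_{i=1}^j\tau_i^{\epsilon_i}=\tau_j^{\epsilon_j}\cdots\tau_1^{\epsilon_1}$ and $\prod_{i=0}^{m}r_i=r_m\cdots r_1r_0$. -}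

module Defs where

open import Data.Nat using (ℕ; zero; suc; _+_; _*_; _∸_; _≤_; _<_; ∣_-_∣; _%_; _/_)
open import Data.Nat.DivMod using (_mod_)
open import Data.Fin using (Fin; toℕ)
open import Data.List using (List; []; _∷_)
open import Data.List.Relation.Unary.All using (All)
open import Data.Product using (Σ; _×_; ∃; _,_)
open import Data.Sum using (_⊎_)
open import Data.Bool using (Bool; true; false; if_then_else_)
open import Relation.Nullary using (¬_; does)
open import Relation.Binary.PropositionalEquality using (_≡_)
open import Data.Nat using (_≟_)

walk : ∀ {n} {F : Set} → (Fin n → F → F) → List (Fin n) → F → F
walk r [] x = x
walk r (c ∷ w) x = walk r w (r c x)

-- An n-maniplex, presented by its set of flags and the involutions r_i
-- (r i x = the flag joined to x by its edge of colour i).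
record Maniplex (n : ℕ) : Set₁ where
  field
    Flag : Set
    r : Fin n → Flag → Flag
    r-invol : ∀ i x → r i (r i x) ≡ x
    r-noloop : ∀ i x → ¬ (r i x ≡ x)
    r-simple : ∀ i j x → ¬ (i ≡ j) → ¬ (r i x ≡ r j x)
    r-comm : ∀ i j x → 1 < ∣ toℕ i - toℕ j ∣ → r i (r j (r i (r j x))) ≡ x
    connected : ∀ x y → ∃ λ (w : List (Fin n)) → walk r w x ≡ y

open Maniplex public

PathIn : ∀ {n} (M : Maniplex n) → (Fin n → Set) → Flag M → Flag M → Set
PathIn M P x y = Σ (List (Fin _)) λ w → All P w × (walk (r M) w x ≡ y)

-- abstract polytope: the path-intersection property
IsPolytope : ∀ {n} → Maniplex n → Set
IsPolytope {n} M = ∀ (m k' : ℕ) (x y : Flag M)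
  → PathIn M (λ c → toℕ c ≤ m) x y
  → PathIn M (λ c → k' ≤ toℕ c) x y
  → PathIn M (λ c → k' ≤ toℕ c × toℕ c ≤ m) x y

-- colour-preserving graph automorphisms; Φ · α = fun α Φ (right action)
record Aut {n} (M : Maniplex n) : Set where
  field
    fun : Flag M → Flag M
    inv : Flag M → Flag M
    inv-fun : ∀ x → inv (fun x) ≡ x
    fun-inv : ∀ x → fun (inv x) ≡ x
    comm : ∀ i x → fun (r M i x) ≡ r M i (fun x)

open Aut public

_·_ : ∀ {n} {M : Maniplex n} → Flag M → Aut M → Flag M
x · α = fun α x

SameOrbit : ∀ {n} (M : Maniplex n) → Flag M → Flag M → Set
SameOrbit M x y = Σ (Aut M) λ α → x · α ≡ y

IsChiral : ∀ {n} → Maniplex n → Set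
IsChiral {n} M =
  (Σ (Flag M) λ x → Σ (Flag M) λ y →
     ¬ SameOrbit M x y × (∀ z → SameOrbit M x z ⊎ SameOrbit M y z))
  × (∀ (i : Fin n) x → ¬ SameOrbit M x (r M i x))

rr : ∀ k (M : Maniplex (suc (2 * k))) → ℕ → Flag M → Flag M
rr k M i = r M (i mod suc (2 * k))

rprod : ∀ k (M : Maniplex (suc (2 * k))) → ℕ → Flag M → Flag M
rprod k M zero x = rr k M 0 x
rprod k M (suc m) x = rr k M (suc m) (rprod k M m x)

-- subscript of τ_i modulo 2k, in the range 1..2k (τ_{2k} for i ≡ 0)
tauIndex : ℕ → ℕ → ℕ
tauIndex zero i = i
tauIndex (suc k) i = suc ((i ∸ 1) % (2 * suc k))

-- ε_i = -1 iff i ≡ 2k+1 (mod 4k); `true` means ε_i = -1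
-- (k = 0 is meaningless and never occurs: there is no chiral 1-polytope)
epsNeg : ℕ → ℕ → Bool
epsNeg zero i = false
epsNeg (suc k) i = does ((i % (4 * suc k)) ≟ ((suc (2 * suc k)) % (4 * suc k)))

fl : ℕ → ℕ → ℕ
fl zero j = 0
fl (suc k) j = (j ∸ 1) / (2 * suc k)

tauPow : ∀ {n} {M : Maniplex n} → ℕ → (ℕ → Aut M) → ℕ → Flag M → Flag M
tauPow k τ i x = if epsNeg k i then inv (τ (tauIndex k i)) x else fun (τ (tauIndex k i)) x

-- Φ ∏_{i=1}^{j} τ_i^{ε_i} = Φ τ_j^{ε_j} ⋯ τ_1^{ε_1}  (right action: τ_j acts first)
tauProd : ∀ {n} {M : Maniplex n} → ℕ → (ℕ → Aut M) → ℕ → Flag M → Flag M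
tauProd k τ zero x = x
tauProd k τ (suc j) x = tauProd k τ j (tauPow k τ (suc j) x)

{-# OPTIONS --safe #-}
-- Automorphisms commute with every r_i, so from Φ τ_t = r_t r₀ Φ and Φ τ_t⁻¹ = r₀ r_t Φ each new factor
-- τ_j^{ε_j} acts on Φ τ_{j-1}^{ε_{j-1}} ⋯ τ_1^{ε_1} as left multiplication by (r_t r₀)^{ε_j}, t ≡ j mod 2k.
-- Group the steps into blocks of 2k.  Inside a block t runs through 2, …, 2k, where r_t commutes with r₀:
-- the sign is irrelevant and each step extends r_m ⋯ r₀ Φ by one letter, the r₀-padding keeping the word of
-- even length.  At the start of a block t = 1 while the word passes r_{2k+1} = r₀, so its index jumps by
-- two; the sign ε = -1 at the start of every other block is exactly what repairs the padding there.
-- Chirality is only used to exclude rank 1 (where r₀ is itself an automorphism).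
module Submission where

open import Defs
open import Data.Nat using (ℕ; zero; suc; pred; _+_; _*_; _≤_; _<_; _%_; _/_; _≟_; ∣_-_∣; s≤s; z≤n; parity)
open import Data.Nat.Properties using (+-comm; +-suc; +-identityʳ; +-monoˡ-≤; *-monoʳ-≤; ≤-refl; ≤-trans; <⇒≤)
open import Data.Nat.DivMod
  using (_mod_; m≡m%n+[m/n]*n; m%n<n; m<n⇒m%n≡m; [m+n]%n≡m%n; [m+kn]%n≡m%n; %-congˡ; %-remove-+ʳ)
open import Data.Nat.Divisibility using (_∣_; divides; n∣m⇒m%n≡0)
open import Data.Nat.Tactic.RingSolver using (solve-∀)
open import Data.Parity.Base as ℙ using (Parity; 0ℙ; 1ℙ; _⁻¹)
import Data.Parity.Properties as ℙ
open import Data.Fin using (zero; toℕ)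
open import Data.Fin.Properties using (toℕ-fromℕ<; fromℕ<-cong)
open import Data.Bool using (Bool; true; false; not; if_then_else_)
open import Data.Product using (_×_; _,_)
open import Data.Empty using (⊥-elim)
open import Relation.Nullary using (¬_; does)
open import Relation.Nullary.Decidable using (dec-true; dec-false)
open import Relation.Binary.PropositionalEquality
  using (_≡_; _≢_; refl; sym; trans; cong; cong₂; subst; module ≡-Reasoning)

open ≡-Reasoning

module _ {n : ℕ} (M : Maniplex n) where

  Commutes : (Flag M → Flag M) → Set
  Commutes f = ∀ i x → f (r M i x) ≡ r M i (f x)

  r-comm-distant : ∀ i j x → 1 < ∣ toℕ i - toℕ j ∣ → r M i (r M j x) ≡ r M j (r M i x)
  r-comm-distant i j x far = begin
    r M i (r M j x)
      ≡⟨ cong (λ y → r M i (r M j y)) (trans (sym (r-invol M i x)) (cong (r M i) (sym (r-invol M j _)))) ⟩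
    r M i (r M j (r M i (r M j (r M j (r M i x)))))
      ≡⟨ r-comm M i j _ far ⟩
    r M j (r M i x) ∎

  inv-commutes : (α : Aut M) → Commutes (inv α)
  inv-commutes α i x = begin
    inv α (r M i x)                  ≡⟨ cong (λ y → inv α (r M i y)) (sym (fun-inv α x)) ⟩
    inv α (r M i (fun α (inv α x)))  ≡⟨ cong (inv α) (sym (comm α i (inv α x))) ⟩
    inv α (fun α (r M i (inv α x)))  ≡⟨ inv-fun α _ ⟩
    r M i (inv α x)                  ∎

  inv-unique : (α : Aut M) → ∀ {x y} → fun α x ≡ y → inv α y ≡ x
  inv-unique α {x} refl = inv-fun α x

  if-inv-fun-commutes : ∀ b (α : Aut M) → Commutes (λ x → if b then inv α x else fun α x)
  if-inv-fun-commutes true  α = inv-commutes α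
  if-inv-fun-commutes false α = comm α

  tauProd-commutes : ∀ k (τ : ℕ → Aut M) j → Commutes (tauProd k τ j)
  tauProd-commutes k τ zero    i x = refl
  tauProd-commutes k τ (suc j) i x =
    trans (cong (tauProd k τ j) (if-inv-fun-commutes (epsNeg k (suc j)) (τ (tauIndex k (suc j))) i x))
          (tauProd-commutes k τ j i _)

rank-one-not-chiral : (M : Maniplex 1) → ¬ IsChiral M
rank-one-not-chiral M ((x , _) , adjacent-apart) = adjacent-apart zero x (r₀ , refl)
  where
  r₀ : Aut M
  r₀ = record { fun = r M zero ; inv = r M zero
              ; inv-fun = r-invol M zero ; fun-inv = r-invol M zero
              ; comm = λ { zero y → refl } }

isEven : Parity → Bool
isEven 0ℙ = true
isEven 1ℙ = false

bit : Parity → ℕ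
bit 0ℙ = 0
bit 1ℙ = 1

%2≡bit∘parity : ∀ m → m % 2 ≡ bit (parity m)
%2≡bit∘parity 0             = refl
%2≡bit∘parity 1             = refl
%2≡bit∘parity (suc (suc m)) = trans (%-congˡ (+-comm 2 m)) (trans ([m+n]%n≡m%n m 2) (%2≡bit∘parity m))

parity-suc : ∀ m → parity (suc m) ≡ parity m ⁻¹
parity-suc m = sym (ℙ.⁻¹-selfInverse (ℙ.suc-homo-⁻¹ m))

parity-*2-+ : ∀ x y z → parity (x * (2 * y) + z) ≡ parity z
parity-*2-+ x y z = begin
  parity (x * (2 * y) + z)                       ≡⟨ ℙ.+-homo-+ (x * (2 * y)) z ⟩
  parity (x * (2 * y)) ℙ.+ parity z              ≡⟨ cong (ℙ._+ parity z) (ℙ.*-homo-* x (2 * y)) ⟩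
  parity x ℙ.* parity (2 * y) ℙ.+ parity z       ≡⟨ cong (λ p → parity x ℙ.* p ℙ.+ parity z) (ℙ.*-homo-* 2 y) ⟩
  parity x ℙ.* 0ℙ ℙ.+ parity z                   ≡⟨ cong (ℙ._+ parity z) (ℙ.*-zeroʳ (parity x)) ⟩
  parity z                                        ∎

parity-+-≡ : ∀ a b → a % 2 ≡ b % 2 → parity (a + b) ≡ 0ℙ
parity-+-≡ a b same = trans (ℙ.+-homo-+ a b)
  (bits-≡ (parity a) (parity b) (trans (sym (%2≡bit∘parity a)) (trans same (%2≡bit∘parity b))))
  where
  bits-≡ : ∀ p q → bit p ≡ bit q → p ℙ.+ q ≡ 0ℙ
  bits-≡ 0ℙ 0ℙ _ = refl
  bits-≡ 1ℙ 1ℙ _ = refl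
  bits-≡ 0ℙ 1ℙ ()
  bits-≡ 1ℙ 0ℙ ()

parity-+-≢ : ∀ a b → a % 2 ≢ b % 2 → parity (a + b) ≡ 1ℙ
parity-+-≢ a b differ = trans (ℙ.+-homo-+ a b)
  (bits-≢ (parity a) (parity b) (λ e → differ (trans (%2≡bit∘parity a) (trans e (sym (%2≡bit∘parity b))))))
  where
  bits-≢ : ∀ p q → bit p ≢ bit q → p ℙ.+ q ≡ 1ℙ
  bits-≢ 0ℙ 0ℙ ne = ⊥-elim (ne refl)
  bits-≢ 1ℙ 1ℙ ne = ⊥-elim (ne refl)
  bits-≢ 0ℙ 1ℙ _  = refl
  bits-≢ 1ℙ 0ℙ _  = refl

module Rank (k : ℕ) (P : Maniplex (suc (2 * k))) where

  private
    n : ℕ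
    n = suc (2 * k)

  rr-%-cong : ∀ a b → a % n ≡ b % n → ∀ x → rr k P a x ≡ rr k P b x
  rr-%-cong a b a≡b x = cong (λ i → r P i x) (fromℕ<-cong _ _ a≡b _ _)

  rr-invol : ∀ t x → rr k P t (rr k P t x) ≡ x
  rr-invol t = r-invol P (t mod n)

  rr-comm-r₀ : ∀ t → 2 ≤ t % n → ∀ x → rr k P 0 (rr k P t x) ≡ rr k P t (rr k P 0 x)
  rr-comm-r₀ t 2≤t x = r-comm-distant P (0 mod n) (t mod n) x (subst (1 <_) (sym (toℕ-fromℕ< _)) 2≤t)

  -- rot false t and rot true t are the images of a base flag under τ_t and τ_t⁻¹;
  -- the Boolean plays the role of epsNeg.
  rot : Bool → ℕ → Flag P → Flag P
  rot false t x = rr k P t (rr k P 0 x)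
  rot true  t x = rr k P 0 (rr k P t x)

  rot-%-cong : ∀ a b → a % n ≡ b % n → ∀ e x → rot e a x ≡ rot e b x
  rot-%-cong a b a≡b false x = rr-%-cong a b a≡b _
  rot-%-cong a b a≡b true  x = cong (rr k P 0) (rr-%-cong a b a≡b x)

  rot-sign-irrelevant : ∀ t → 2 ≤ t % n → ∀ e e′ x → rot e t x ≡ rot e′ t x
  rot-sign-irrelevant t 2≤t false false x = refl
  rot-sign-irrelevant t 2≤t true  true  x = refl
  rot-sign-irrelevant t 2≤t true  false x = rr-comm-r₀ t 2≤t x
  rot-sign-irrelevant t 2≤t false true  x = sym (rr-comm-r₀ t 2≤t x)

  rot-inverse : ∀ e t x → rot (not e) t (rot e t x) ≡ x
  rot-inverse false t x = trans (cong (rr k P 0) (rr-invol t _)) (rr-invol 0 x)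
  rot-inverse true  t x = trans (cong (rr k P t) (rr-invol 0 _)) (rr-invol t x)

  rot-natural : ∀ {f} → Commutes P f → ∀ e t x → f (rot e t x) ≡ rot e t (f x)
  rot-natural f-comm false t x = trans (f-comm _ _) (cong (rr k P t) (f-comm _ x))
  rot-natural f-comm true  t x = trans (f-comm _ _) (cong (rr k P 0) (f-comm _ x))

  padEven : Parity → Flag P → Flag P
  padEven 0ℙ x = rr k P 0 x
  padEven 1ℙ x = x

  -- r₀^[m even] r_m ⋯ r₁ r₀ x: the padding makes the word have even length.
  evenRprod : ℕ → Flag P → Flag P
  evenRprod m x = padEven (parity m) (rprod k P m x)

  evenRprod-suc : ∀ m → 2 ≤ suc m % n → ∀ e x → evenRprod (suc m) x ≡ rot e (suc m) (evenRprod m x)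
  evenRprod-suc m 2≤t e x = begin
    padEven (parity (suc m)) (rr k P (suc m) X)  ≡⟨ cong (λ p → padEven p (rr k P (suc m) X)) (parity-suc m) ⟩
    padEven (parity m ⁻¹) (rr k P (suc m) X)     ≡⟨ pad-flip (parity m) ⟩
    rot false (suc m) (padEven (parity m) X)     ≡⟨ rot-sign-irrelevant (suc m) 2≤t false e _ ⟩
    rot e (suc m) (evenRprod m x)                ∎
    where
    X : Flag P
    X = rprod k P m x
    pad-flip : ∀ p → padEven (p ⁻¹) (rr k P (suc m) X) ≡ rot false (suc m) (padEven p X)
    pad-flip 0ℙ = cong (rr k P (suc m)) (sym (rr-invol 0 X))
    pad-flip 1ℙ = rr-comm-r₀ (suc m) 2≤t X

  evenRprod-wrap : ∀ m → n ∣ suc m → ∀ x → evenRprod (2 + m) x ≡ rot (isEven (parity m)) 1 (evenRprod m x)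
  evenRprod-wrap m n∣1+m x = begin
    padEven (parity m) (rprod k P (2 + m) x)   ≡⟨ cong (padEven (parity m)) rprod-wrap ⟩
    padEven (parity m) (rot false 1 X)         ≡⟨ pad-rot₁ (parity m) ⟩
    rot (isEven (parity m)) 1 (evenRprod m x)  ∎
    where
    X : Flag P
    X = rprod k P m x
    rprod-wrap : rr k P (2 + m) (rr k P (suc m) X) ≡ rr k P 1 (rr k P 0 X)
    rprod-wrap = trans (rr-%-cong (2 + m) 1 (%-remove-+ʳ 1 n∣1+m) _)
                       (cong (rr k P 1) (rr-%-cong (suc m) 0 (n∣m⇒m%n≡0 _ n n∣1+m) X))
    pad-rot₁ : ∀ p → padEven p (rot false 1 X) ≡ rot (isEven p) 1 (padEven p X)
    pad-rot₁ 0ℙ = refl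
    pad-rot₁ 1ℙ = refl

tauIndex-block : ∀ k q s → s < 2 * suc k → tauIndex (suc k) (suc (s + q * (2 * suc k))) ≡ suc s
tauIndex-block k q s s<2K = cong suc (trans ([m+kn]%n≡m%n s q (2 * suc k)) (m<n⇒m%n≡m s<2K))

epsNeg-periodic : ∀ k i → epsNeg (suc k) (i + 4 * suc k) ≡ epsNeg (suc k) i
epsNeg-periodic k i = cong (λ x → does (x ≟ suc (2 * suc k) % (4 * suc k))) ([m+n]%n≡m%n i (4 * suc k))

epsNeg-block-start : ∀ k q → epsNeg (suc k) (suc (q * (2 * suc k))) ≡ isEven (parity (suc q))
epsNeg-block-start k 0 = dec-false (_ ≟ _) λ 1≡2K+1 →
  1≢2K+1 (trans (sym (m<n⇒m%n≡m 1<4K)) (trans 1≡2K+1 (m<n⇒m%n≡m 2K+1<4K)))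
  where
  2K+1<4K : suc (2 * suc k) < 4 * suc k
  2K+1<4K = subst (2 + 2 * suc k ≤_) (2K+2K≡4K k) (+-monoˡ-≤ (2 * suc k) (*-monoʳ-≤ 2 (s≤s z≤n)))
    where
    2K+2K≡4K : ∀ k → 2 * suc k + 2 * suc k ≡ 4 * suc k
    2K+2K≡4K = solve-∀
  1<4K : 1 < 4 * suc k
  1<4K = ≤-trans (s≤s (s≤s z≤n)) 2K+1<4K
  1≢2K+1 : 1 ≢ suc (2 * suc k)
  1≢2K+1 ()
epsNeg-block-start k 1 = dec-true (_ ≟ _) (cong (λ i → suc i % (4 * suc k)) (+-identityʳ (2 * suc k)))
epsNeg-block-start k (suc (suc q)) =
  trans (cong (epsNeg (suc k)) (shift k q))
        (trans (epsNeg-periodic k (suc (q * (2 * suc k)))) (epsNeg-block-start k q))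
  where
  shift : ∀ k q → suc (suc (suc q) * (2 * suc k)) ≡ suc (q * (2 * suc k)) + 4 * suc k
  shift = solve-∀

module Rotations (k : ℕ) (P : Maniplex (suc (2 * suc k))) (Φ : Flag P) (τ : ℕ → Aut P)
  (τ-Φ : ∀ t → 1 ≤ t → t ≤ 2 * suc k → Φ · τ t ≡ rr (suc k) P t (rr (suc k) P 0 Φ)) where

  open Rank (suc k) P

  private
    N : ℕ
    N = 2 * suc k

  τ^±-Φ : ∀ e t → 1 ≤ t → t ≤ N → (if e then inv (τ t) Φ else fun (τ t) Φ) ≡ rot e t Φ
  τ^±-Φ false t 1≤t t≤N = τ-Φ t 1≤t t≤N
  τ^±-Φ true  t 1≤t t≤N = inv-unique P (τ t) (begin
    fun (τ t) (rot true t Φ)        ≡⟨ rot-natural (comm (τ t)) true t Φ ⟩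
    rot true t (fun (τ t) Φ)        ≡⟨ cong (rot true t) (τ-Φ t 1≤t t≤N) ⟩
    rot true t (rot false t Φ)      ≡⟨ rot-inverse false t Φ ⟩
    Φ                               ∎)

  tauProd-suc : ∀ j → tauProd (suc k) τ (suc j) Φ
              ≡ rot (epsNeg (suc k) (suc j)) (tauIndex (suc k) (suc j)) (tauProd (suc k) τ j Φ)
  tauProd-suc j = trans (cong (tauProd (suc k) τ j) (τ^±-Φ e t (s≤s z≤n) (m%n<n j N)))
                        (rot-natural (tauProd-commutes P (suc k) τ j) e t Φ)
    where
    e : Bool
    e = epsNeg (suc k) (suc j)
    t : ℕ
    t = tauIndex (suc k) (suc j)

  -- j = 1 + s + q·2k is the (s+1)-st step of the q-th block of 2k steps, and ⌊(j-1)/2k⌋ = q.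
  Matches : ℕ → ℕ → Set
  Matches q s = tauProd (suc k) τ (suc (s + q * N)) Φ ≡ evenRprod (suc (s + q * N) + q) Φ

  matches-first : Matches 0 0
  matches-first = trans (tauProd-suc 0) (cong (λ e → rot e 1 Φ) (epsNeg-block-start k 0))

  matches-suc : ∀ q s → suc s < N → Matches q s → Matches q (suc s)
  matches-suc q s 1+s<N ih = begin
    tauProd (suc k) τ (suc j) Φ                              ≡⟨ tauProd-suc j ⟩
    rot e (tauIndex (suc k) (suc j)) (tauProd (suc k) τ j Φ)  ≡⟨ cong₂ (rot e) (tauIndex-block k q (suc s) 1+s<N) ih ⟩
    rot e (2 + s) (evenRprod m Φ)                            ≡⟨ rot-%-cong (2 + s) (suc m) (sym 1+m%n≡2+s%n) e _ ⟩
    rot e (suc m) (evenRprod m Φ)                            ≡⟨ evenRprod-suc m 2≤1+m%n e Φ ⟨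
    evenRprod (suc m) Φ                                      ∎
    where
    j m : ℕ
    j = suc (s + q * N)
    m = j + q
    e : Bool
    e = epsNeg (suc k) (suc j)
    1+m≡ : ∀ s q k → suc (suc (s + q * (2 * suc k)) + q) ≡ 2 + s + q * suc (2 * suc k)
    1+m≡ = solve-∀
    2+s%n≡2+s : (2 + s) % suc N ≡ 2 + s
    2+s%n≡2+s = m<n⇒m%n≡m (s≤s 1+s<N)
    1+m%n≡2+s%n : suc m % suc N ≡ (2 + s) % suc N
    1+m%n≡2+s%n = trans (cong (_% suc N) (1+m≡ s q k)) ([m+kn]%n≡m%n (2 + s) q (suc N))
    2≤1+m%n : 2 ≤ suc m % suc N
    2≤1+m%n = subst (2 ≤_) (sym (trans 1+m%n≡2+s%n 2+s%n≡2+s)) (s≤s (s≤s z≤n))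

  matches-wrap : ∀ q → Matches q (pred N) → Matches (suc q) 0
  matches-wrap q ih = begin
    tauProd (suc k) τ (suc j) Φ
      ≡⟨ tauProd-suc j ⟩
    rot (epsNeg (suc k) (suc j)) (tauIndex (suc k) (suc j)) (tauProd (suc k) τ j Φ)
      ≡⟨ cong (λ t → rot (epsNeg (suc k) (suc j)) t (tauProd (suc k) τ j Φ)) (tauIndex-block k (suc q) 0 (s≤s z≤n)) ⟩
    rot (epsNeg (suc k) (suc j)) 1 (tauProd (suc k) τ j Φ)
      ≡⟨ cong₂ (λ e x → rot e 1 x) (epsNeg-block-start k (suc q)) ih ⟩
    rot (isEven (parity q)) 1 (evenRprod m Φ)
      ≡⟨ cong (λ p → rot (isEven p) 1 (evenRprod m Φ)) (parity-*2-+ (suc q) (suc k) q) ⟨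
    rot (isEven (parity m)) 1 (evenRprod m Φ)
      ≡⟨ evenRprod-wrap m (divides (suc q) (1+m≡ q k)) Φ ⟨
    evenRprod (2 + m) Φ
      ≡⟨ cong (λ i → evenRprod (suc i) Φ) (+-suc j q) ⟨
    evenRprod (suc j + suc q) Φ
      ∎
    where
    j m : ℕ
    j = suc q * N
    m = j + q
    1+m≡ : ∀ q k → suc (suc q * (2 * suc k) + q) ≡ suc q * suc (2 * suc k)
    1+m≡ = solve-∀

  matches-block : ∀ q → Matches q 0 → ∀ s → s < N → Matches q s
  matches-block q first zero    _     = first
  matches-block q first (suc s) 1+s<N = matches-suc q s 1+s<N (matches-block q first s (<⇒≤ 1+s<N))

  matches-block-start : ∀ q → Matches q 0
  matches-block-start zero    = matches-first
  matches-block-start (suc q) = matches-wrap q (matches-block q (matches-block-start q) (pred N) ≤-refl)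

  tauProd≡evenRprod : ∀ j → 1 ≤ j → tauProd (suc k) τ j Φ ≡ evenRprod (j + fl (suc k) j) Φ
  tauProd≡evenRprod (suc j) _ =
    subst (λ i → tauProd (suc k) τ (suc i) Φ ≡ evenRprod (suc i + q) Φ) (sym (m≡m%n+[m/n]*n j N))
          (matches-block q (matches-block-start q) (j % N) (m%n<n j N))
    where
    q : ℕ
    q = j / N

proposition7p1 : (k : ℕ) (P : Maniplex (suc (2 * k))) → IsPolytope P → IsChiral P
    → (Φ : Flag P) (τ : ℕ → Aut P)
    → (∀ i → 1 ≤ i → i ≤ 2 * k → Φ · τ i ≡ rr k P i (rr k P 0 Φ))
    → (j : ℕ) → 1 ≤ j
    → (¬ (j % 2 ≡ fl k j % 2) → tauProd k τ j Φ ≡ rprod k P (j + fl k j) Φ)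
      × (j % 2 ≡ fl k j % 2 → tauProd k τ j Φ ≡ rr k P 0 (rprod k P (j + fl k j) Φ))
proposition7p1 zero    P _ chiral _ _ _ _ _ = ⊥-elim (rank-one-not-chiral P chiral)
proposition7p1 (suc k) P _ _ Φ τ τ-Φ j 1≤j =
    (λ differ → trans matches (cong (λ p → padEven p X) (parity-+-≢ j f differ)))
  , (λ same → trans matches (cong (λ p → padEven p X) (parity-+-≡ j f same)))
  where
  open Rank (suc k) P
  open Rotations k P Φ τ τ-Φ
  f : ℕ
  f = fl (suc k) j
  X : Flag P
  X = rprod (suc k) P (j + f) Φ
  matches : tauProd (suc k) τ j Φ ≡ padEven (parity (j + f)) X
  matches = tauProd≡evenRprod j 1≤j
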